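{- Let $D$ be a connected mixed graph and $\alpha\in\mathbb{C}$ with $|\alpha|=1$. Then $D$ is an $\alpha$-monograph of first kind if and only if $V(D)$ can be partitioned into sets $V_z$, indexed by $z\in\{\alpha^j: j\in\mathbb{Z}\}$ (some possibly empty), such that there is no digon between vertices of two different sets, and every arc starting in a set $V_{\alpha^j}$ ends in $V_{\alpha^{j-1}}$.
   Context: A mixed graph $D$ is obtained from a finite simple undirected graph $\Gamma(D)$ by replacing some edges by arcs: between any two adjacent vertices $u,v$ there is exactly one of a digon $u\sim v$, an arc $u\to v$ (starting at $u$, ending at $v$), or an arc $v\to u$; connectedness and cycles refer to $\Gamma(D)$. For $|\alpha|=1$ set $h_{uv}=1$ if $u\sim v$, $\alpha$ if $u\to v$, $\bar\alpha$ if $v\to u$. A mixed walk $W=v_1,\dots,v_k$ has value $h_\alpha(W)=h_{v_1v_2}\cdots h_{v_{k-1}v_k}$. For a cycle $C$ with vertices $v_1,\dots,v_\ell$ in cyclic order, a traversal $\vec C$ is the closed walk $v_1,\dots,v_\ell,v_1$ (either direction, any start). $D$ is an $\alpha$-monograph of first kind if $h_\alpha(\vec C)=1$ for every cycle $C$ and every traversal $\vec C$. -}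

module Defs where

open import Level using (Level; _⊔_)
open import Data.Nat using (ℕ; zero; suc; _≤_)
open import Data.Integer using (ℤ; +_; -[1+_]; 1ℤ)
import Data.Integer as ℤ
open import Data.Fin using (Fin)
open import Data.List using (List; []; _∷_; _++_; [_]; length)
open import Data.List.Relation.Unary.Unique.Propositional using (Unique)
open import Data.Product using (_×_; ∃)
open import Data.Unit using (⊤)
open import Relation.Binary.PropositionalEquality using (_≡_; _≢_)
open import Algebra.Bundles using (AbelianGroup)

-- Relation between an ordered pair (u , v) of vertices.
data Edge : Set where
  nonadj  : Edge
  digon   : Edge
  arcTo   : Edge
  arcFrom : Edge

flipE : Edge → Edge
flipE nonadj  = nonadj
flipE digon   = digon
flipE arcTo   = arcFrom
flipE arcFrom = arcTo

record MixedGraph : Set where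
  field
    n        : ℕ
    kind     : Fin n → Fin n → Edge
    symm     : ∀ u v → kind v u ≡ flipE (kind u v)
    loopless : ∀ u → kind u u ≡ nonadj

module _ (D : MixedGraph) where
  open MixedGraph D

  V : Set
  V = Fin n

  Adj : V → V → Set
  Adj u v = kind u v ≢ nonadj

  data Path : V → V → Set where
    here : ∀ {u} → Path u u
    step : ∀ {u w v} → Adj u w → Path w v → Path u v

  Connected : Set
  Connected = ∀ u v → Path u v

  Chain : List V → Set
  Chain []            = ⊤
  Chain (x ∷ [])      = ⊤
  Chain (x ∷ y ∷ r)   = Adj x y × Chain (y ∷ r)

  closeUp : List V → List V
  closeUp []       = []
  closeUp (v ∷ vs) = v ∷ vs ++ [ v ]

  -- Every traversal (any start, either direction) of every cycle is such a list.
  IsCycleTraversal : List V → Set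
  IsCycleTraversal vs = (3 ≤ length vs) × Unique vs × Chain (closeUp vs)

module _ {c ℓ : Level} (G : AbelianGroup c ℓ) (α : AbelianGroup.Carrier G) where
  open AbelianGroup G

  -- ᾱ = α⁻¹ (for |α| = 1 the complex conjugate is the inverse)
  hE : Edge → Carrier
  hE nonadj  = ε
  hE digon   = ε
  hE arcTo   = α
  hE arcFrom = α ⁻¹

  powℕ : ℕ → Carrier
  powℕ zero    = ε
  powℕ (suc k) = α ∙ powℕ k

  pow : ℤ → Carrier
  pow (+ k)      = powℕ k
  pow -[1+ k ]   = (powℕ (suc k)) ⁻¹

  module _ (D : MixedGraph) where
    open MixedGraph D

    hWalk : List (Fin n) → Carrier
    hWalk []            = ε
    hWalk (x ∷ [])      = ε
    hWalk (x ∷ y ∷ r)   = hE (kind x y) ∙ hWalk (y ∷ r)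

    FirstKindMonograph : Set ℓ
    FirstKindMonograph =
      ∀ (vs : List (Fin n)) → IsCycleTraversal D vs → hWalk (closeUp D vs) ≈ ε

    -- V(D) partitioned into sets V_z, z ∈ {α^j : j ∈ ℤ}: each vertex v lies in
    -- V_{lab v}; no digon between different sets; arcs from V_{α^j} end in V_{α^(j-1)}.
    GoodPartition : Set (c ⊔ ℓ)
    GoodPartition =
      ∃ λ (lab : Fin n → Carrier) →
        (∀ v → ∃ λ (j : ℤ) → lab v ≈ pow j)
        × (∀ u v → kind u v ≡ digon → lab u ≈ lab v)
        × (∀ u v → kind u v ≡ arcTo → ∀ (j : ℤ) → lab u ≈ pow j → lab v ≈ pow (j ℤ.- 1ℤ))

-- Read h_α as a gain on the underlying graph Γ(D) with values in the group generated
-- by α.  A labelling of the kind described is exactly a potential f with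
-- h(u,v) · f v = f u on every edge, taking values in powers of α; a potential makes
-- the value of every walk telescope, so closed walks (in particular traversals of
-- cycles) have value 1.  Conversely, a closed walk with a repeated vertex splits into
-- two shorter closed walks, and one without repetitions is a cycle traversal or goes
-- back and forth along a single edge, so on a monograph every closed walk has value
-- 1.  The value of a path to a fixed root then does not depend on the path, and this
-- value is the required potential.
module Submission where

open import Defs
open import Level using (Level)
open import Algebra.Bundles using (AbelianGroup)
open import Function.Bundles using (_⇔_; mk⇔)

open import Data.Nat using (zero; suc; _+_; _<_; z≤n; s≤s)
open import Data.Nat.Properties using (m≤n+m; m<m+n; +-monoʳ-<; <-≤-trans; +-comm)
open import Data.Nat.Induction using (<-wellFounded)
open import Data.Integer using (ℤ; +_; -[1+_]; 1ℤ)
import Data.Integer as ℤ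
open import Data.Fin using (Fin; _≟_)
open import Data.List using (List; []; _∷_; _++_; [_]; length)
open import Data.List.Properties using (length-++; ++-assoc)
open import Data.List.Relation.Unary.Unique.Propositional using (Unique)
open import Data.List.Relation.Unary.AllPairs using ([]; _∷_)
open import Data.List.Relation.Unary.All.Properties.Core using (¬Any⇒All¬)
open import Data.List.Membership.Propositional.Properties using (∈-∃++)
import Data.List.Membership.DecPropositional as DecMembership
open import Data.Product using (_×_; ∃; _,_; proj₁; proj₂)
open import Data.Sum using (_⊎_; inj₁; inj₂)
open import Data.Unit using (tt)
open import Data.Empty using (⊥-elim)
open import Induction.WellFounded using (Acc; acc)
open import Relation.Nullary using (yes; no)
open import Relation.Binary.Definitions using (DecidableEquality)
open import Relation.Binary.PropositionalEquality using (_≡_; _≢_; cong)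
import Relation.Binary.PropositionalEquality as ≡

module _ {a} {A : Set a} where

  Repetition : List A → Set a
  Repetition xs = ∃ λ p → ∃ λ x → ∃ λ q → ∃ λ t → xs ≡ p ++ x ∷ q ++ x ∷ t

  unique-or-repetition : DecidableEquality A → ∀ xs → Unique xs ⊎ Repetition xs
  unique-or-repetition _≟A_ [] = inj₁ []
  unique-or-repetition _≟A_ (x ∷ xs) with x ∈? xs | unique-or-repetition _≟A_ xs
    where open DecMembership _≟A_ using (_∈?_)
  ... | yes x∈xs | _ = let q , t , eq = ∈-∃++ x∈xs in inj₂ ([] , x , q , t , cong (x ∷_) eq)
  ... | no x∉xs | inj₁ u = inj₁ (¬Any⇒All¬ xs x∉xs ∷ u)
  ... | no _ | inj₂ (p , y , q , t , eq) = inj₂ (x ∷ p , y , q , t , cong (x ∷_) eq)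

  length-repetition : ∀ p (x : A) q t →
    length (p ++ x ∷ q ++ x ∷ t) ≡ length p + suc (length q + suc (length t))
  length-repetition p x q t = ≡.trans (length-++ p) (cong (λ m → length p + suc m) (length-++ q))

  loop-shorter : ∀ p (x : A) q t → length (x ∷ q) < length (p ++ x ∷ q ++ x ∷ t)
  loop-shorter p x q t rewrite length-repetition p x q t =
    <-≤-trans (s≤s (m<m+n (length q) (s≤s z≤n))) (m≤n+m _ (length p))

  excised-shorter : ∀ p (x : A) q t → length (p ++ x ∷ t) < length (p ++ x ∷ q ++ x ∷ t)
  excised-shorter p x q t rewrite length-repetition p x q t | length-++ p {x ∷ t} =
    +-monoʳ-< (length p) (s≤s (m≤n+m (suc (length t)) (length q)))

module _ {c ℓ : Level} (G : AbelianGroup c ℓ) (α : AbelianGroup.Carrier G) where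
  open AbelianGroup G
  open import Algebra.Properties.Group group using (identityˡ-unique; ∙-cancelʳ)
  open import Algebra.Properties.AbelianGroup G using (⁻¹-∙-comm)
  open import Algebra.Properties.Monoid monoid using (cancelˡ)
  open import Algebra.Properties.CommutativeSemigroup commutativeSemigroup using (x∙yz≈y∙xz)
  open import Relation.Binary.Reasoning.Setoid setoid

  private
    h : Edge → Carrier
    h = hE G α

    αⁿ : ℤ → Carrier
    αⁿ = pow G α

  α∙pow : ∀ j → α ∙ αⁿ j ≈ αⁿ (j ℤ.+ 1ℤ)
  α∙pow (+ k) = reflexive (cong (λ m → αⁿ (+ m)) (+-comm 1 k))
  α∙pow -[1+ zero ] = trans (∙-congˡ (⁻¹-cong (identityʳ α))) (inverseʳ α)
  α∙pow -[1+ suc k ] = begin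
    α ∙ (α ∙ (α ∙ powℕ G α k)) ⁻¹      ≈⟨ ∙-congˡ (sym (⁻¹-∙-comm α _)) ⟩
    α ∙ (α ⁻¹ ∙ (α ∙ powℕ G α k) ⁻¹)   ≈⟨ cancelˡ (inverseʳ α) _ ⟩
    (α ∙ powℕ G α k) ⁻¹                ∎

  α⁻¹∙pow : ∀ j → α ⁻¹ ∙ αⁿ j ≈ αⁿ (j ℤ.- 1ℤ)
  α⁻¹∙pow (+ zero) = trans (identityʳ (α ⁻¹)) (⁻¹-cong (sym (identityʳ α)))
  α⁻¹∙pow (+ suc k) = cancelˡ (inverseˡ α) _
  α⁻¹∙pow -[1+ k ] = begin
    α ⁻¹ ∙ (α ∙ powℕ G α k) ⁻¹   ≈⟨ ⁻¹-∙-comm α _ ⟩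
    (α ∙ (α ∙ powℕ G α k)) ⁻¹    ≈⟨ reflexive (cong (λ m → αⁿ -[1+ m ]) (+-comm 0 (suc k))) ⟩
    αⁿ -[1+ suc k + 0 ]          ∎

  hE-flipE : ∀ e → h e ∙ h (flipE e) ≈ ε
  hE-flipE nonadj  = identityˡ ε
  hE-flipE digon   = identityˡ ε
  hE-flipE arcTo   = inverseʳ α
  hE-flipE arcFrom = inverseˡ α

  hE∙pow : ∀ e j → ∃ λ k → h e ∙ αⁿ j ≈ αⁿ k
  hE∙pow nonadj  j = j , identityˡ (αⁿ j)
  hE∙pow digon   j = j , identityˡ (αⁿ j)
  hE∙pow arcTo   j = j ℤ.+ 1ℤ , α∙pow j
  hE∙pow arcFrom j = j ℤ.- 1ℤ , α⁻¹∙pow j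

  module _ (D : MixedGraph) where
    open MixedGraph D

    private
      hW : List (V D) → Carrier
      hW = hWalk G α D

    Potential : (V D → Carrier) → Set ℓ
    Potential f = ∀ u v → Adj D u v → h (kind u v) ∙ f v ≈ f u

    ClosedWalksTrivial : Set ℓ
    ClosedWalksTrivial = ∀ vs → Chain D (closeUp D vs) → hW (closeUp D vs) ≈ ε

    hWalk-++ : ∀ p x q → hW (p ++ x ∷ q) ≈ hW (p ++ [ x ]) ∙ hW (x ∷ q)
    hWalk-++ []          x q = sym (identityˡ _)
    hWalk-++ (u ∷ [])    x q = ∙-congʳ (sym (identityʳ _))
    hWalk-++ (u ∷ v ∷ p) x q = trans (∙-congˡ (hWalk-++ (v ∷ p) x q)) (sym (assoc _ _ _))

    Chain-++⁻ : ∀ p x q → Chain D (p ++ x ∷ q) → Chain D (p ++ [ x ]) × Chain D (x ∷ q)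
    Chain-++⁻ []          x q ch        = tt , ch
    Chain-++⁻ (u ∷ [])    x q (uv , ch) = (uv , tt) , ch
    Chain-++⁻ (u ∷ v ∷ p) x q (uv , ch) = let ch₁ , ch₂ = Chain-++⁻ (v ∷ p) x q ch in (uv , ch₁) , ch₂

    Chain-++⁺ : ∀ p x q → Chain D (p ++ [ x ]) → Chain D (x ∷ q) → Chain D (p ++ x ∷ q)
    Chain-++⁺ []          x q _         ch₂ = ch₂
    Chain-++⁺ (u ∷ [])    x q (uv , _)  ch₂ = uv , ch₂
    Chain-++⁺ (u ∷ v ∷ p) x q (uv , ch₁) ch₂ = uv , Chain-++⁺ (v ∷ p) x q ch₁ ch₂

    hWalk-excise : ∀ p x q t → hW (p ++ x ∷ q ++ x ∷ t) ≈ hW (x ∷ q ++ [ x ]) ∙ hW (p ++ x ∷ t)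
    hWalk-excise p x q t = begin
      hW (p ++ x ∷ q ++ x ∷ t)                            ≈⟨ hWalk-++ p x (q ++ x ∷ t) ⟩
      hW (p ++ [ x ]) ∙ hW (x ∷ q ++ x ∷ t)               ≈⟨ ∙-congˡ (hWalk-++ (x ∷ q) x t) ⟩
      hW (p ++ [ x ]) ∙ (hW (x ∷ q ++ [ x ]) ∙ hW (x ∷ t)) ≈⟨ x∙yz≈y∙xz _ _ _ ⟩
      hW (x ∷ q ++ [ x ]) ∙ (hW (p ++ [ x ]) ∙ hW (x ∷ t)) ≈⟨ ∙-congˡ (sym (hWalk-++ p x t)) ⟩
      hW (x ∷ q ++ [ x ]) ∙ hW (p ++ x ∷ t)               ∎

    Chain-excise : ∀ p x q t → Chain D (p ++ x ∷ q ++ x ∷ t) →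
                   Chain D (x ∷ q ++ [ x ]) × Chain D (p ++ x ∷ t)
    Chain-excise p x q t ch =
      let ch₁ , ch₂ = Chain-++⁻ p x (q ++ x ∷ t) ch
          ch₃ , ch₄ = Chain-++⁻ (x ∷ q) x t ch₂
      in ch₃ , Chain-++⁺ p x t ch₁ ch₄

    private
      firstOr : V D → List (V D) → V D
      firstOr x []      = x
      firstOr _ (u ∷ _) = u

    closeUp-++ : ∀ p x r → closeUp D (p ++ x ∷ r) ≡ p ++ x ∷ r ++ [ firstOr x p ]
    closeUp-++ []      x r = ≡.refl
    closeUp-++ (u ∷ p) x r = cong (u ∷_) (++-assoc p (x ∷ r) [ u ])

    closeUp-repetition : ∀ p x q t →
      closeUp D (p ++ x ∷ q ++ x ∷ t) ≡ p ++ x ∷ q ++ x ∷ t ++ [ firstOr x p ]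
    closeUp-repetition p x q t =
      ≡.trans (closeUp-++ p x (q ++ x ∷ t)) (cong (λ r → p ++ x ∷ r) (++-assoc q (x ∷ t) [ firstOr x p ]))

    hWalk-closeUp-excise : ∀ p x q t →
      hW (closeUp D (p ++ x ∷ q ++ x ∷ t)) ≈ hW (closeUp D (x ∷ q)) ∙ hW (closeUp D (p ++ x ∷ t))
    hWalk-closeUp-excise p x q t rewrite closeUp-repetition p x q t | closeUp-++ p x t =
      hWalk-excise p x q (t ++ [ firstOr x p ])

    Chain-closeUp-excise : ∀ p x q t → Chain D (closeUp D (p ++ x ∷ q ++ x ∷ t)) →
      Chain D (closeUp D (x ∷ q)) × Chain D (closeUp D (p ++ x ∷ t))
    Chain-closeUp-excise p x q t rewrite closeUp-repetition p x q t | closeUp-++ p x t =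
      Chain-excise p x q (t ++ [ firstOr x p ])

    backAndForth-trivial : ∀ u v → hW (closeUp D (u ∷ v ∷ [])) ≈ ε
    backAndForth-trivial u v = begin
      h (kind u v) ∙ (h (kind v u) ∙ ε)   ≈⟨ ∙-congˡ (identityʳ _) ⟩
      h (kind u v) ∙ h (kind v u)         ≡⟨ cong (λ e → h (kind u v) ∙ h e) (symm u v) ⟩
      h (kind u v) ∙ h (flipE (kind u v)) ≈⟨ hE-flipE (kind u v) ⟩
      ε                                   ∎

    monograph⇒repetitionFreeClosedWalksTrivial : FirstKindMonograph G α D →
      ∀ vs → Unique vs → Chain D (closeUp D vs) → hW (closeUp D vs) ≈ ε
    monograph⇒repetitionFreeClosedWalksTrivial mono []               _    _          = refl
    monograph⇒repetitionFreeClosedWalksTrivial mono (u ∷ [])         _    (u~u , _)  = ⊥-elim (u~u (loopless u))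
    monograph⇒repetitionFreeClosedWalksTrivial mono (u ∷ v ∷ [])     _    _          = backAndForth-trivial u v
    monograph⇒repetitionFreeClosedWalksTrivial mono (u ∷ v ∷ w ∷ vs) uniq ch         =
      mono (u ∷ v ∷ w ∷ vs) (s≤s (s≤s (s≤s z≤n)) , uniq , ch)

    monograph⇒closedWalksTrivial : FirstKindMonograph G α D → ClosedWalksTrivial
    monograph⇒closedWalksTrivial mono vs = go vs (<-wellFounded (length vs))
      where
      go : ∀ vs → Acc _<_ (length vs) → Chain D (closeUp D vs) → hW (closeUp D vs) ≈ ε
      go vs (acc shorter) ch with unique-or-repetition _≟_ vs
      ... | inj₁ uniq = monograph⇒repetitionFreeClosedWalksTrivial mono vs uniq ch
      ... | inj₂ (p , x , q , t , ≡.refl) = begin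
        hW (closeUp D (p ++ x ∷ q ++ x ∷ t))                   ≈⟨ hWalk-closeUp-excise p x q t ⟩
        hW (closeUp D (x ∷ q)) ∙ hW (closeUp D (p ++ x ∷ t))   ≈⟨ ∙-cong (go _ (shorter (loop-shorter p x q t)) loop)
                                                                         (go _ (shorter (excised-shorter p x q t)) rest) ⟩
        ε ∙ ε                                                   ≈⟨ identityˡ ε ⟩
        ε                                                       ∎
        where
        loop = proj₁ (Chain-closeUp-excise p x q t ch)
        rest = proj₂ (Chain-closeUp-excise p x q t ch)

    potential-telescopes : ∀ {f} → Potential f →
      ∀ x r y → Chain D (x ∷ r ++ [ y ]) → hW (x ∷ r ++ [ y ]) ∙ f y ≈ f x
    potential-telescopes pot x []      y (x~y , _) = trans (∙-congʳ (identityʳ _)) (pot x y x~y)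
    potential-telescopes {f} pot x (z ∷ r) y (x~z , ch) = begin
      (h (kind x z) ∙ hW (z ∷ r ++ [ y ])) ∙ f y  ≈⟨ assoc _ _ _ ⟩
      h (kind x z) ∙ (hW (z ∷ r ++ [ y ]) ∙ f y)  ≈⟨ ∙-congˡ (potential-telescopes pot z r y ch) ⟩
      h (kind x z) ∙ f z                          ≈⟨ pot x z x~z ⟩
      f x                                         ∎

    potential⇒monograph : ∀ {f} → Potential f → FirstKindMonograph G α D
    potential⇒monograph pot []       (() , _)
    potential⇒monograph pot (v ∷ vs) (_ , _ , ch) = identityˡ-unique _ _ (potential-telescopes pot v vs v ch)

    goodPartition⇒potential : (gp : GoodPartition G α D) → Potential (proj₁ gp)
    goodPartition⇒potential (lab , inPowers , digonSame , arcDown) = potential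
      where
      arcUp : ∀ u v → kind u v ≡ arcTo → α ∙ lab v ≈ lab u
      arcUp u v eq = let j , lab-u≈αʲ = inPowers u in begin
        α ∙ lab v               ≈⟨ ∙-congˡ (arcDown u v eq j lab-u≈αʲ) ⟩
        α ∙ αⁿ (j ℤ.- 1ℤ)       ≈⟨ ∙-congˡ (sym (α⁻¹∙pow j)) ⟩
        α ∙ (α ⁻¹ ∙ αⁿ j)       ≈⟨ cancelˡ (inverseʳ α) _ ⟩
        αⁿ j                    ≈⟨ sym lab-u≈αʲ ⟩
        lab u                   ∎

      potential : Potential lab
      potential u v u~v with kind u v in eq
      ... | nonadj  = ⊥-elim (u~v ≡.refl)
      ... | digon   = trans (identityˡ _) (sym (digonSame u v eq))
      ... | arcTo   = arcUp u v eq
      ... | arcFrom = begin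
        α ⁻¹ ∙ lab v         ≈⟨ ∙-congˡ (sym (arcUp v u (≡.trans (symm u v) (cong flipE eq)))) ⟩
        α ⁻¹ ∙ (α ∙ lab u)   ≈⟨ cancelˡ (inverseˡ α) _ ⟩
        lab u                ∎

    adjacent : ∀ {u v e} → kind u v ≡ e → e ≢ nonadj → Adj D u v
    adjacent eq e≢nonadj kind≡nonadj = e≢nonadj (≡.trans (≡.sym eq) kind≡nonadj)

    potential⇒goodPartition : ∀ f → Potential f → (∀ v → ∃ λ j → f v ≈ αⁿ j) → GoodPartition G α D
    potential⇒goodPartition f potential inPowers = f , inPowers , digonSame , arcDown
      where
      digonSame : ∀ u v → kind u v ≡ digon → f u ≈ f v
      digonSame u v eq = begin
        f u                 ≈⟨ sym (potential u v (adjacent eq λ ())) ⟩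
        h (kind u v) ∙ f v  ≡⟨ cong (λ e → h e ∙ f v) eq ⟩
        ε ∙ f v             ≈⟨ identityˡ (f v) ⟩
        f v                 ∎

      arcDown : ∀ u v → kind u v ≡ arcTo → ∀ j → f u ≈ αⁿ j → f v ≈ αⁿ (j ℤ.- 1ℤ)
      arcDown u v eq j f-u≈αʲ = begin
        f v                          ≈⟨ sym (cancelˡ (inverseˡ α) (f v)) ⟩
        α ⁻¹ ∙ (α ∙ f v)             ≡⟨ cong (λ e → α ⁻¹ ∙ (h e ∙ f v)) (≡.sym eq) ⟩
        α ⁻¹ ∙ (h (kind u v) ∙ f v)  ≈⟨ ∙-congˡ (trans (potential u v (adjacent eq λ ())) f-u≈αʲ) ⟩
        α ⁻¹ ∙ αⁿ j                  ≈⟨ α⁻¹∙pow j ⟩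
        αⁿ (j ℤ.- 1ℤ)                ∎

    pathValue : ∀ {u v} → Path D u v → Carrier
    pathValue here               = ε
    pathValue (step {u} {w} _ p) = h (kind u w) ∙ pathValue p

    _++ₚ_ : ∀ {u w v} → Path D u w → Path D w v → Path D u v
    here       ++ₚ q = q
    step u~w p ++ₚ q = step u~w (p ++ₚ q)

    pathValue-++ₚ : ∀ {u w v} (p : Path D u w) (q : Path D w v) →
      pathValue (p ++ₚ q) ≈ pathValue p ∙ pathValue q
    pathValue-++ₚ here       q = sym (identityˡ _)
    pathValue-++ₚ (step _ p) q = trans (∙-congˡ (pathValue-++ₚ p q)) (sym (assoc _ _ _))

    pathValue-pow : ∀ {u v} (p : Path D u v) → ∃ λ j → pathValue p ≈ αⁿ j
    pathValue-pow here = + 0 , refl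
    pathValue-pow (step {u} {w} _ p) =
      let j , p≈αʲ = pathValue-pow p
          k , step≈αᵏ = hE∙pow (kind u w) j
      in k , trans (∙-congˡ p≈αʲ) step≈αᵏ

    -- all but the last vertex
    vertices : ∀ {u v} → Path D u v → List (V D)
    vertices here           = []
    vertices (step {u} _ p) = u ∷ vertices p

    Chain-vertices : ∀ {u v} (p : Path D u v) → Chain D (vertices p ++ [ v ])
    Chain-vertices here                   = tt
    Chain-vertices (step u~w here)        = u~w , tt
    Chain-vertices (step u~w (step w~x p)) = u~w , Chain-vertices (step w~x p)

    hWalk-vertices : ∀ {u v} (p : Path D u v) → hW (vertices p ++ [ v ]) ≈ pathValue p
    hWalk-vertices here                 = refl
    hWalk-vertices (step _ here)        = refl
    hWalk-vertices (step _ (step w~x p)) = ∙-congˡ (hWalk-vertices (step w~x p))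

    closedPath-trivial : ClosedWalksTrivial → ∀ {u} (p : Path D u u) → pathValue p ≈ ε
    closedPath-trivial trivial here         = refl
    closedPath-trivial trivial p@(step _ _) =
      trans (sym (hWalk-vertices p)) (trivial (vertices p) (Chain-vertices p))

    pathValue-unique : ClosedWalksTrivial → ∀ {u v} → Path D v u →
      (p q : Path D u v) → pathValue p ≈ pathValue q
    pathValue-unique trivial back p q = ∙-cancelʳ (pathValue back) _ _ (begin
      pathValue p ∙ pathValue back  ≈⟨ sym (pathValue-++ₚ p back) ⟩
      pathValue (p ++ₚ back)        ≈⟨ closedPath-trivial trivial (p ++ₚ back) ⟩
      ε                             ≈⟨ sym (closedPath-trivial trivial (q ++ₚ back)) ⟩
      pathValue (q ++ₚ back)        ≈⟨ pathValue-++ₚ q back ⟩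
      pathValue q ∙ pathValue back  ∎)

    closedWalksTrivial⇒goodPartition : ClosedWalksTrivial → Connected D → V D → GoodPartition G α D
    closedWalksTrivial⇒goodPartition trivial conn root =
      potential⇒goodPartition distance potential (λ v → pathValue-pow (conn v root))
      where
      distance : V D → Carrier
      distance v = pathValue (conn v root)

      potential : Potential distance
      potential u v u~v = pathValue-unique trivial (conn root u) (step u~v (conn v root)) (conn u root)

monograph⇒goodPartition : ∀ {c ℓ : Level} (G : AbelianGroup c ℓ) (α : AbelianGroup.Carrier G) (D : MixedGraph) →
  Connected D → FirstKindMonograph G α D → GoodPartition G α D
monograph⇒goodPartition G α record { n = zero }    _    _    = (λ ()) , (λ ()) , (λ ()) , (λ ())
monograph⇒goodPartition G α D@record { n = suc _ } conn mono =
  closedWalksTrivial⇒goodPartition G α D (monograph⇒closedWalksTrivial G α D mono) conn Fin.zero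

theorem5p9 : ∀ {c ℓ : Level} (G : AbelianGroup c ℓ) (α : AbelianGroup.Carrier G) (D : MixedGraph) →
    Connected D → (FirstKindMonograph G α D ⇔ GoodPartition G α D)
theorem5p9 G α D conn = mk⇔
  (monograph⇒goodPartition G α D conn)
  (λ gp → potential⇒monograph G α D (goodPartition⇒potential G α D gp))
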